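{- Let $t_n=(-1)^{s_2(n)}$, $h_0=0$, $h_1=1$, and $h_n=t_nh_{n-1}+h_{n-2}$ for $n\ge2$. For $n\in\mathbb{N}$ we have $h_n\equiv 0\pmod 2$ if and only if $n\equiv 0\pmod 3$.
   Context: $s_2(n)$ denotes the number of 1's in the binary expansion of $n$; $(t_n)$ is the Prouhet–Thue–Morse sequence. -}

module Defs where

open import Data.Nat using (ℕ; zero; suc; _+_; _%_; _/_)
open import Data.Integer using (ℤ; +_; -_; _*_) renaming (_+_ to _+ℤ_)

-- s₂ n : number of 1's in the binary expansion of n.
-- Computed with fuel (fuel ≥ n suffices, since n/2 < n for n > 0).
s₂-fuel : ℕ → ℕ → ℕ
s₂-fuel zero    n = 0
s₂-fuel (suc f) zero = 0
s₂-fuel (suc f) (suc m) = (suc m % 2) + s₂-fuel f (suc m / 2)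

s₂ : ℕ → ℕ
s₂ n = s₂-fuel n n

neg1^ : ℕ → ℤ
neg1^ zero = + 1
neg1^ (suc k) = - neg1^ k

t : ℕ → ℤ
t n = neg1^ (s₂ n)

h : ℕ → ℤ
h zero = + 0
h (suc zero) = + 1
h (suc (suc n)) = t (suc (suc n)) * h (suc n) +ℤ h n

-- Every t n is ±1, hence odd, so modulo 2 the recurrence reduces to the
-- Fibonacci recurrence h (n+2) ≡ h (n+1) + h n. Starting from (even, odd),
-- the parities then cycle through even, odd, odd with period 3.
module Submission where

open import Defs
open import Data.Nat using (ℕ; _%_)
open import Data.Integer using (+_)
open import Data.Integer.Divisibility using (_∣_)
open import Relation.Binary.PropositionalEquality using (_≡_)
open import Function.Bundles using (_⇔_)

open import Data.Nat as ℕ using (zero; suc; _<_; s<s)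
open import Data.Nat.DivMod using (m≡m%n+[m/n]*n; m%n<n)
import Data.Nat.Divisibility as ℕ
open import Data.Integer as ℤ using (ℤ; -_)
open import Data.Integer.Properties using (+-comm)
open import Data.Integer.Divisibility.Signed as Signed
  using (divides; ∣ᵤ⇒∣; ∣⇒∣ᵤ; ∣n⇒∣m*n; ∣m+n∣m⇒∣n)
open import Data.Integer.Tactic.RingSolver using (solve-∀)
open import Data.Product using (∃-syntax; _,_; _×_; proj₁; proj₂)
open import Relation.Nullary using (¬_)
open import Relation.Binary.PropositionalEquality using (refl; sym; subst)
open import Function.Bundles using (mk⇔; module Equivalence)
open import Function.Base using (_∘′_)
open import Data.Empty using (⊥-elim)

-- Signed divisibility, which interacts well with + and *; lemma3 is stated with
-- the unsigned one and converts at the end.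
Even : ℤ → Set
Even x = + 2 Signed.∣ x

Odd : ℤ → Set
Odd x = ∃[ k ] x ≡ k ℤ.* + 2 ℤ.+ + 1

odd*odd : ∀ {x y} → Odd x → Odd y → Odd (x ℤ.* y)
odd*odd (a , refl) (b , refl) = a ℤ.* b ℤ.* + 2 ℤ.+ a ℤ.+ b , identity a b
  where
  identity : ∀ a b → (a ℤ.* + 2 ℤ.+ + 1) ℤ.* (b ℤ.* + 2 ℤ.+ + 1)
                   ≡ (a ℤ.* b ℤ.* + 2 ℤ.+ a ℤ.+ b) ℤ.* + 2 ℤ.+ + 1
  identity = solve-∀

even+odd : ∀ {x y} → Even x → Odd y → Odd (x ℤ.+ y)
even+odd (divides q refl) (k , refl) = q ℤ.+ k , identity q k
  where
  identity : ∀ q k → q ℤ.* + 2 ℤ.+ (k ℤ.* + 2 ℤ.+ + 1) ≡ (q ℤ.+ k) ℤ.* + 2 ℤ.+ + 1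
  identity = solve-∀

odd+even : ∀ {x y} → Odd x → Even y → Odd (x ℤ.+ y)
odd+even {x} {y} o e = subst Odd (+-comm y x) (even+odd e o)

odd+odd : ∀ {x y} → Odd x → Odd y → Even (x ℤ.+ y)
odd+odd (a , refl) (b , refl) = divides (a ℤ.+ b ℤ.+ + 1) (identity a b)
  where
  identity : ∀ a b → (a ℤ.* + 2 ℤ.+ + 1) ℤ.+ (b ℤ.* + 2 ℤ.+ + 1) ≡ (a ℤ.+ b ℤ.+ + 1) ℤ.* + 2
  identity = solve-∀

odd-neg : ∀ {x} → Odd x → Odd (- x)
odd-neg (a , refl) = - a ℤ.- + 1 , identity a
  where
  identity : ∀ a → - (a ℤ.* + 2 ℤ.+ + 1) ≡ (- a ℤ.- + 1) ℤ.* + 2 ℤ.+ + 1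
  identity = solve-∀

odd⇒¬even : ∀ {x} → Odd x → ¬ Even x
odd⇒¬even (k , refl) 2∣x with ℕ.∣1⇒≡1 (∣⇒∣ᵤ (∣m+n∣m⇒∣n 2∣x (divides k refl)))
... | ()

odd-neg1^ : ∀ k → Odd (neg1^ k)
odd-neg1^ zero    = + 0 , refl
odd-neg1^ (suc k) = odd-neg (odd-neg1^ k)

module OddCoefficientRecurrence
  (u c : ℕ → ℤ)
  (c-odd : ∀ n → Odd (c n))
  (u-rec : ∀ n → u (2 ℕ.+ n) ≡ c n ℤ.* u (1 ℕ.+ n) ℤ.+ u n)
  (u₀-even : Even (u 0))
  (u₁-odd : Odd (u 1))
  where

  ParityPattern : ℕ → Set
  ParityPattern m = Even (u (m ℕ.* 3)) × Odd (u (1 ℕ.+ m ℕ.* 3)) × Odd (u (2 ℕ.+ m ℕ.* 3))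

  odd,odd⇒even : ∀ n → Odd (u (1 ℕ.+ n)) → Odd (u n) → Even (u (2 ℕ.+ n))
  odd,odd⇒even n o₁ o₀ = subst Even (sym (u-rec n)) (odd+odd (odd*odd (c-odd n) o₁) o₀)

  even,odd⇒odd : ∀ n → Even (u (1 ℕ.+ n)) → Odd (u n) → Odd (u (2 ℕ.+ n))
  even,odd⇒odd n e₁ o₀ = subst Odd (sym (u-rec n)) (even+odd (∣n⇒∣m*n (c n) e₁) o₀)

  odd,even⇒odd : ∀ n → Odd (u (1 ℕ.+ n)) → Even (u n) → Odd (u (2 ℕ.+ n))
  odd,even⇒odd n o₁ e₀ = subst Odd (sym (u-rec n)) (odd+even (odd*odd (c-odd n) o₁) e₀)

  parityPattern : ∀ m → ParityPattern m
  parityPattern zero = u₀-even , u₁-odd , odd,even⇒odd 0 u₁-odd u₀-even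
  parityPattern (suc m) with parityPattern m
  ... | _ , o₁ , o₂ = e₃ , o₄ , odd,even⇒odd (3 ℕ.+ m ℕ.* 3) o₄ e₃
    where
    e₃ : Even (u (3 ℕ.+ m ℕ.* 3))
    e₃ = odd,odd⇒even (1 ℕ.+ m ℕ.* 3) o₂ o₁
    o₄ : Odd (u (4 ℕ.+ m ℕ.* 3))
    o₄ = even,odd⇒odd (2 ℕ.+ m ℕ.* 3) e₃ o₂

  even-by-residue : ∀ r m → r < 3 → Even (u (r ℕ.+ m ℕ.* 3)) ⇔ r ≡ 0
  even-by-residue 0 m _ = mk⇔ (λ _ → refl) (λ _ → proj₁ (parityPattern m))
  even-by-residue 1 m _ = mk⇔ (⊥-elim ∘′ odd⇒¬even (proj₁ (proj₂ (parityPattern m)))) λ ()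
  even-by-residue 2 m _ = mk⇔ (⊥-elim ∘′ odd⇒¬even (proj₂ (proj₂ (parityPattern m)))) λ ()
  even-by-residue (suc (suc (suc _))) _ (s<s (s<s (s<s ())))

  even⇔mod3≡0 : ∀ n → Even (u n) ⇔ n % 3 ≡ 0
  even⇔mod3≡0 n = subst (λ k → Even (u k) ⇔ n % 3 ≡ 0) (sym (m≡m%n+[m/n]*n n 3))
                        (even-by-residue (n % 3) (n ℕ./ 3) (m%n<n n 3))

open OddCoefficientRecurrence h (λ n → t (2 ℕ.+ n)) (λ n → odd-neg1^ (s₂ (2 ℕ.+ n)))
  (λ _ → refl) (divides (+ 0) refl) (+ 0 , refl)

lemma3 : (n : ℕ) → ((+ 2) ∣ h n) ⇔ (n % 3 ≡ 0)
lemma3 n = mk⇔ (to ∘′ ∣ᵤ⇒∣) (∣⇒∣ᵤ ∘′ from)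
  where open Equivalence (even⇔mod3≡0 n)
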